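{- For every string $T\in[1..\sigma]^{n-1}\#$ with $\sigma<n-1$, the number of arcs of $\mathsf{CDAWG}_T$ is $\Omega(\log n)$.
   Context: Alphabet $[1..\sigma]$, separator $\#=0$; $T=T[1..n]\in[1..\sigma]^{n-1}\#$. For a string $W$, $\mathcal{P}_T(W)$ is the set of starting positions of $W$ in the circular version of $T$; $\Sigma^{\ell}_T(W)=\{a\in[0..\sigma]:\mathcal{P}_T(aW)\neq\emptyset\}$, $\Sigma^{r}_T(W)=\{b:\mathcal{P}_T(Wb)\neq\emptyset\}$; $W$ is a repeat if $|\mathcal{P}_T(W)|>1$; a repeat is right-maximal if $|\Sigma^{r}_T(W)|>1$, left-maximal if $|\Sigma^{\ell}_T(W)|>1$, a maximal repeat if both. $\mathsf{ST}_T$ is the suffix tree of $T$, $\ell(v)$ the label of node $v$. Equivalence class of a maximal repeat $W$ of length $m$: with $k+1$ the smallest $j\in[2..m+1]$ such that $W[j..m]$ is left-maximal, the class is $\{W[1..m],\dots,W[k..m]\}$; every right-maximal string belongs to the class of exactly one maximal repeat. $\mathsf{CDAWG}_T$ has one node per maximal repeat of $T$ plus a sink; for each maximal repeat $V$ and each child $u$ of the node of $\mathsf{ST}_T$ labeled $V$, there is one arc from the node of $V$ to the node whose equivalence class contains $\ell(u)$, or to the sink if $u$ is a leaf. The $\Omega$ is with respect to $n$, uniformly over all such $T$ and $\sigma$. -}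

module Defs where

open import Data.Nat using (ℕ; zero; suc; _+_; _≤_; _<_)
open import Data.Nat.DivMod using (_mod_)
open import Data.Fin using (Fin; fromℕ; inject₁)
open import Data.List using (List; []; _∷_; _++_; [_])
open import Data.Product using (_×_; Σ; ∃; ∃-syntax)
open import Data.Unit using (⊤)
open import Relation.Binary.PropositionalEquality using (_≡_; _≢_)

-- A text of length n = suc m is a function T : Fin (suc m) → ℕ
-- (position k, 0-based, holds T[k+1] of the paper).

-- T ∈ [1..σ]^{n-1} #  with # = 0
ValidText : (m σ : ℕ) → (Fin (suc m) → ℕ) → Set
ValidText m σ T =
  (T (fromℕ m) ≡ 0) × ((i : Fin m) → (1 ≤ T (inject₁ i)) × (T (inject₁ i) ≤ σ))

circ : {m : ℕ} → (Fin (suc m) → ℕ) → ℕ → ℕ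
circ {m} T k = T (k mod (suc m))

OccAt : (ℕ → ℕ) → ℕ → List ℕ → Set
OccAt f k []      = ⊤
OccAt f k (a ∷ W) = (f k ≡ a) × OccAt f (suc k) W

InP : {m : ℕ} → (Fin (suc m) → ℕ) → List ℕ → Fin (suc m) → Set
InP T W i = OccAt (circ T) (Data.Fin.toℕ i) W

Occurs : {m : ℕ} → (Fin (suc m) → ℕ) → List ℕ → Set
Occurs T W = ∃[ i ] InP T W i

Repeat : {m : ℕ} → (Fin (suc m) → ℕ) → List ℕ → Set
Repeat T W = ∃[ i ] ∃[ j ] (i ≢ j × InP T W i × InP T W j)

InSigmaL : {m : ℕ} → ℕ → (Fin (suc m) → ℕ) → List ℕ → ℕ → Set
InSigmaL σ T W a = (a ≤ σ) × Occurs T (a ∷ W)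

InSigmaR : {m : ℕ} → ℕ → (Fin (suc m) → ℕ) → List ℕ → ℕ → Set
InSigmaR σ T W b = (b ≤ σ) × Occurs T (W ++ [ b ])

LeftMaximal : {m : ℕ} → ℕ → (Fin (suc m) → ℕ) → List ℕ → Set
LeftMaximal σ T W = ∃[ a ] ∃[ a' ] (a ≢ a' × InSigmaL σ T W a × InSigmaL σ T W a')

RightMaximal : {m : ℕ} → ℕ → (Fin (suc m) → ℕ) → List ℕ → Set
RightMaximal σ T W = ∃[ b ] ∃[ b' ] (b ≢ b' × InSigmaR σ T W b × InSigmaR σ T W b')

MaximalRepeat : {m : ℕ} → ℕ → (Fin (suc m) → ℕ) → List ℕ → Set
MaximalRepeat σ T W = Repeat T W × LeftMaximal σ T W × RightMaximal σ T W

-- Arcs of CDAWG_T: for each maximal repeat V and each child u of the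
-- suffix-tree node labeled V there is exactly one arc.  The children of
-- the node labeled V are in bijection with the characters b ∈ Σ^r_T(V)
-- (child u has ℓ(u) starting with V b), so an arc is identified by the
-- pair (V , b).
CDAWGArc : {m : ℕ} → ℕ → (Fin (suc m) → ℕ) → List ℕ × ℕ → Set
CDAWGArc σ T (V Data.Product., b) = MaximalRepeat σ T V × InSigmaR σ T V b

module Submission where

-- Idea: say that the suffix at position i uses the arc (V , b) when some suffix U of V
-- in the equivalence class of V (every occurrence of U extends to V) is followed by b at
-- i; this is the arc of the CDAWG path spelled by that suffix.  For positions i ≠ j let
-- W be the longest common prefix of the two suffixes, followed by b ≠ b'; extending W
-- to the left as far as all its occurrences agree gives a maximal repeat V, and (V , b)
-- is an arc used by i but not by j.  So the n positions have pairwise distinct sets of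
-- used arcs, whence n ≤ 2 ^ #arcs.  The one non-trivial step is that j cannot use
-- (V , b) through a suffix of V other than W: two such nested suffixes at a common
-- position make the longer one overlap itself, and a self-overlapping word covers a
-- separator #, which forces all its occurrences to coincide.

open import Defs
open import Data.Nat using (ℕ; zero; suc; _+_; _*_; _∸_; _^_; _≤_; _<_; _≟_; _≤?_; z≤n; s≤s)
open import Data.Nat.Properties
open import Data.Nat.DivMod
  using (_%_; _/_; _mod_; m%n<n; m%n%n≡m%n; [m+kn]%n≡m%n; %-distribˡ-+; m≡m%n+[m/n]*n; m<n⇒m%n≡m)
open import Data.Nat.Induction using (<-rec)
open import Data.Nat.Logarithm using (⌊log₂_⌋; ⌊log₂⌋-mono-≤; ⌊log₂[2^n]⌋≡n)
open import Data.Nat.Tactic.RingSolver using (solve-∀)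
open import Data.Fin as F using (Fin; fromℕ; inject₁; toℕ; funToFin; finToFun)
import Data.Fin.Properties as FP
open import Data.List using (List; []; _∷_; _++_; [_]; length; drop; lookup)
open import Data.List.Properties using (length-drop)
open import Data.List.Membership.Propositional using (_∈_)
open import Data.List.Relation.Unary.Any using (index)
open import Data.List.Relation.Unary.Any.Properties using (lookup-index)
open import Data.List.Relation.Unary.Unique.Propositional using (Unique)
open import Data.Product using (Σ; _×_; _,_; proj₁; proj₂; ∃; ∃-syntax)
open import Data.Sum using (_⊎_; inj₁; inj₂)
open import Data.Unit using (tt)
open import Data.Empty using (⊥; ⊥-elim)
open import Function.Bundles using (_⇔_; Equivalence)
open import Relation.Nullary using (Dec; yes; no; ¬_)
open import Relation.Nullary.Decidable using (_×-dec_; _→-dec_; ¬?; decidable-stable)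
open import Relation.Binary.Definitions using (Tri; tri<; tri≈; tri>)
open import Relation.Binary.PropositionalEquality
  using (_≡_; _≢_; refl; sym; trans; cong; cong₂; subst; subst₂; module ≡-Reasoning)

least : (P : ℕ → Set) → (∀ k → Dec (P k)) → ∀ k₀ → P k₀ →
        Σ ℕ λ k → P k × (∀ k' → k' < k → ¬ P k')
least P P? k₀ pk₀ = go 0 k₀ refl (λ _ ())
  where
  go : ∀ a b → a + b ≡ k₀ → (∀ k' → k' < a → ¬ P k') → Σ ℕ λ k → P k × (∀ k' → k' < k → ¬ P k')
  go a b a+b≡k₀ below with P? a
  ... | yes pa = a , pa , below
  go a zero a+0≡k₀ below | no ¬pa = ⊥-elim (¬pa (subst P (trans (sym a+0≡k₀) (+-identityʳ a)) pk₀))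
  go a (suc b) a+1+b≡k₀ below | no ¬pa = go (suc a) b (trans (sym (+-suc a b)) a+1+b≡k₀) below′
    where
    below′ : ∀ k' → k' < suc a → ¬ P k'
    below′ k' k'<1+a with m≤n⇒m<n∨m≡n (≤-pred k'<1+a)
    ... | inj₁ k'<a = below k' k'<a
    ... | inj₂ refl = ¬pa

-- Arithmetic of positions in a circular text of length n = suc m.
module Congruence (m : ℕ) where

  n : ℕ
  n = suc m

  infix 4 _≈_

  record _≈_ (x y : ℕ) : Set where
    constructor mk≈
    field residue : x % n ≡ y % n

  ≈-refl : ∀ {x} → x ≈ x
  ≈-refl = mk≈ refl

  ≈-sym : ∀ {x y} → x ≈ y → y ≈ x
  ≈-sym (mk≈ e) = mk≈ (sym e)

  ≈-trans : ∀ {x y z} → x ≈ y → y ≈ z → x ≈ z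
  ≈-trans (mk≈ e) (mk≈ e') = mk≈ (trans e e')

  ≡⇒≈ : ∀ {x y} → x ≡ y → x ≈ y
  ≡⇒≈ refl = ≈-refl

  +-congˡ-≈ : ∀ k {x y} → x ≈ y → k + x ≈ k + y
  +-congˡ-≈ k {x} {y} (mk≈ e) = mk≈ (begin
      (k + x) % n           ≡⟨ %-distribˡ-+ k x n ⟩
      (k % n + x % n) % n   ≡⟨ cong (λ r → (k % n + r) % n) e ⟩
      (k % n + y % n) % n   ≡⟨ %-distribˡ-+ k y n ⟨
      (k + y) % n           ∎)
    where open ≡-Reasoning

  +-congʳ-≈ : ∀ k {x y} → x ≈ y → x + k ≈ y + k
  +-congʳ-≈ k {x} {y} e rewrite +-comm x k | +-comm y k = +-congˡ-≈ k e

  +-turns : ∀ x k → x + k * n ≈ x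
  +-turns x k = mk≈ ([m+kn]%n≡m%n x k n)

  +-turn : ∀ x → x + n ≈ x
  +-turn x = ≈-trans (≡⇒≈ (cong (x +_) (sym (+-identityʳ n)))) (+-turns x 1)

  +-cancelˡ-≈ : ∀ a {x y} → a + x ≈ a + y → x ≈ y
  +-cancelˡ-≈ a {x} {y} e = ≈-trans (≈-sym (around x)) (≈-trans (+-congˡ-≈ c e) (around y))
    where
    -- c + a is a whole number of turns
    c : ℕ
    c = n ∸ a % n

    c+a : c + a ≡ suc (a / n) * n
    c+a = begin
        c + a                        ≡⟨ cong (c +_) (m≡m%n+[m/n]*n a n) ⟩
        c + (a % n + (a / n) * n)    ≡⟨ +-assoc c (a % n) _ ⟨
        (c + a % n) + (a / n) * n    ≡⟨ cong (_+ (a / n) * n) (m∸n+n≡m (<⇒≤ (m%n<n a n))) ⟩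
        n + (a / n) * n              ∎
      where open ≡-Reasoning

    around : ∀ z → c + (a + z) ≈ z
    around z = ≈-trans (≡⇒≈ (begin
        c + (a + z)          ≡⟨ +-assoc c a z ⟨
        c + a + z            ≡⟨ cong (_+ z) c+a ⟩
        suc (a / n) * n + z  ≡⟨ +-comm _ z ⟩
        z + suc (a / n) * n  ∎)) (+-turns z (suc (a / n)))
      where open ≡-Reasoning

  +-cancelʳ-≈ : ∀ a {x y} → x + a ≈ y + a → x ≈ y
  +-cancelʳ-≈ a {x} {y} e rewrite +-comm x a | +-comm y a = +-cancelˡ-≈ a e

  -- d * m + x is the position d steps to the left of x
  back : ∀ d x → d * m + x + d ≈ x
  back d x = ≈-trans (≡⇒≈ (rearrange d m x)) (+-turns x d)
    where
    rearrange : ∀ d m x → d * m + x + d ≡ x + d * suc m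
    rearrange = solve-∀

  back-suc : ∀ d x → suc (suc d * m + x) ≈ d * m + x
  back-suc d x = ≈-trans (≡⇒≈ (rearrange m d x)) (+-turn (d * m + x))
    where
    rearrange : ∀ m d x → suc (m + d * m + x) ≡ d * m + x + suc m
    rearrange = solve-∀

  toℕ-mod-≈ : ∀ x → toℕ (x mod n) ≈ x
  toℕ-mod-≈ x = mk≈ (trans (cong (_% n) (FP.toℕ-fromℕ< (m%n<n x n))) (m%n%n≡m%n x n))

  mod-cong : ∀ {x y} → x ≈ y → x mod n ≡ y mod n
  mod-cong {x} {y} (mk≈ e) =
    FP.toℕ-injective (trans (FP.toℕ-fromℕ< (m%n<n x n)) (trans e (sym (FP.toℕ-fromℕ< (m%n<n y n)))))

  toℕ-≈-injective : ∀ {i j : Fin n} → toℕ i ≈ toℕ j → i ≡ j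
  toℕ-≈-injective {i} {j} (mk≈ e) =
    FP.toℕ-injective (trans (sym (m<n⇒m%n≡m (FP.toℕ<n i))) (trans e (m<n⇒m%n≡m (FP.toℕ<n j))))

-- Occurrences of words in an arbitrary stream f.
module Occurrence (f : ℕ → ℕ) where

  Occ : ℕ → List ℕ → Set
  Occ = OccAt f

  Occ? : ∀ x X → Dec (Occ x X)
  Occ? x []      = yes tt
  Occ? x (a ∷ X) = (f x ≟ a) ×-dec Occ? (suc x) X

  occ-++⁻ : ∀ x A B → Occ x (A ++ B) → Occ x A × Occ (x + length A) B
  occ-++⁻ x [] B o rewrite +-identityʳ x = tt , o
  occ-++⁻ x (a ∷ A) B (e , o) with occ-++⁻ (suc x) A B o
  ... | oA , oB rewrite +-suc x (length A) = (e , oA) , oB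

  occ-++⁺ : ∀ x A B → Occ x A → Occ (x + length A) B → Occ x (A ++ B)
  occ-++⁺ x [] B _ oB rewrite +-identityʳ x = oB
  occ-++⁺ x (a ∷ A) B (e , oA) oB rewrite +-suc x (length A) = e , occ-++⁺ (suc x) A B oA oB

  occ-snoc : ∀ x X c → Occ x X → f (x + length X) ≡ c → Occ x (X ++ [ c ])
  occ-snoc x X c oX e = occ-++⁺ x X [ c ] oX (e , tt)

  snoc-char : ∀ x X c → Occ x (X ++ [ c ]) → f (x + length X) ≡ c
  snoc-char x X c o = proj₁ (proj₂ (occ-++⁻ x X [ c ] o))

  occ-drop : ∀ x d X → Occ x X → Occ (x + d) (drop d X)
  occ-drop x zero X o rewrite +-identityʳ x = o
  occ-drop x (suc d) [] o = tt
  occ-drop x (suc d) (a ∷ X) (_ , o) rewrite +-suc x d = occ-drop (suc x) d X o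

  occ-agree : ∀ x y X k → Occ x X → Occ y X → k < length X → f (x + k) ≡ f (y + k)
  occ-agree x y (a ∷ X) zero (e , _) (e' , _) _ rewrite +-identityʳ x | +-identityʳ y = trans e (sym e')
  occ-agree x y (a ∷ X) (suc k) (_ , o) (_ , o') (s≤s k<|X|)
    rewrite +-suc x k | +-suc y k = occ-agree (suc x) (suc y) X k o o' k<|X|

  -- if U and X occur at a common position and U is not longer, U is a prefix of X,
  -- so U occurs wherever X does
  occ-prefix : ∀ p x U X → Occ p U → Occ p X → length U ≤ length X → Occ x X → Occ x U
  occ-prefix p x [] X _ _ _ _ = tt
  occ-prefix p x (u ∷ U) (a ∷ X) (e , oU) (e' , oX) (s≤s |U|≤|X|) (e'' , o) =
    trans e'' (trans (sym e') e) , occ-prefix (suc p) (suc x) U X oU oX |U|≤|X| o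

  factor : ℕ → ℕ → List ℕ
  factor s zero    = []
  factor s (suc L) = f s ∷ factor (suc s) L

  factor-occ : ∀ s L → Occ s (factor s L)
  factor-occ s zero    = tt
  factor-occ s (suc L) = refl , factor-occ (suc s) L

  length-factor : ∀ s L → length (factor s L) ≡ L
  length-factor s zero    = refl
  length-factor s (suc L) = cong suc (length-factor (suc s) L)

  drop-factor : ∀ s d L → drop d (factor s (d + L)) ≡ factor (s + d) L
  drop-factor s zero L    = cong (λ x → factor x L) (sym (+-identityʳ s))
  drop-factor s (suc d) L rewrite +-suc s d = drop-factor (suc s) d L

  occ-factor : ∀ s x L → (∀ k → k < L → f (s + k) ≡ f (x + k)) → Occ x (factor s L)
  occ-factor s x zero    _     = tt
  occ-factor s x (suc L) agree =
    sym (subst₂ (λ a c → f a ≡ f c) (+-identityʳ s) (+-identityʳ x) (agree 0 (s≤s z≤n))) ,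
    occ-factor (suc s) (suc x) L
      (λ k k<L → subst₂ (λ a c → f a ≡ f c) (+-suc s k) (+-suc x k) (agree (suc k) (s≤s k<L)))

-- Streams of period n = suc m, i.e. circular texts read from any position.
module PeriodicStream (m : ℕ) (f : ℕ → ℕ) (periodic : ∀ {x y} → Congruence._≈_ m x y → f x ≡ f y) where

  open Congruence m
  open Occurrence f

  occ-≈ : ∀ {x y} X → x ≈ y → Occ x X → Occ y X
  occ-≈ []      _ _       = tt
  occ-≈ (a ∷ X) e (e' , o) = trans (sym (periodic e)) e' , occ-≈ X (+-congˡ-≈ 1 e) o

  factor-≈ : ∀ {s s'} L → s ≈ s' → factor s L ≡ factor s' L
  factor-≈ zero    _ = refl
  factor-≈ (suc L) e = cong₂ _∷_ (periodic e) (factor-≈ L (+-congˡ-≈ 1 e))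

  -- Preceded d X Y: every occurrence of X is preceded, d positions earlier, by an
  -- occurrence of Y; it suffices to check one period, which makes it decidable.
  Preceded : ℕ → List ℕ → List ℕ → Set
  Preceded d X Y = (q : Fin n) → Occ (toℕ q + d) X → Occ (toℕ q) Y

  Preceded? : ∀ d X Y → Dec (Preceded d X Y)
  Preceded? d X Y = FP.all? (λ q → Occ? (toℕ q + d) X →-dec Occ? (toℕ q) Y)

  preceded : ∀ {d X Y} → Preceded d X Y → ∀ z → Occ (z + d) X → Occ z Y
  preceded {d} {X} {Y} pre z o =
    occ-≈ Y (toℕ-mod-≈ z) (pre (z mod n) (occ-≈ X (+-congʳ-≈ d (≈-sym (toℕ-mod-≈ z))) o))

  module Separated (separator : f m ≡ 0) (only-separator : ∀ x → f x ≡ 0 → x ≈ m) where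

    separator-ahead : ∀ s → Σ ℕ λ t → t < n × f (s + t) ≡ 0
    separator-ahead s = t , s≤s (m∸n≤m m (s % n)) , trans (periodic s+t≈m) separator
      where
      t : ℕ
      t = m ∸ s % n

      s+t≡ : s + t ≡ m + (s / n) * n
      s+t≡ = begin
          s + t                      ≡⟨ cong (_+ t) (m≡m%n+[m/n]*n s n) ⟩
          s % n + (s / n) * n + t    ≡⟨ +-assoc (s % n) _ t ⟩
          s % n + ((s / n) * n + t)  ≡⟨ cong (s % n +_) (+-comm _ t) ⟩
          s % n + (t + (s / n) * n)  ≡⟨ +-assoc (s % n) t _ ⟨
          s % n + t + (s / n) * n    ≡⟨ cong (_+ (s / n) * n) (m+[n∸m]≡n (≤-pred (m%n<n s n))) ⟩
          m + (s / n) * n            ∎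
        where open ≡-Reasoning

      s+t≈m : s + t ≈ m
      s+t≈m = ≈-trans (≡⇒≈ s+t≡) (+-turns m (s / n))

    same-separator : ∀ x y k → f (x + k) ≡ 0 → f (y + k) ≡ 0 → x ≈ y
    same-separator x y k fx fy = +-cancelʳ-≈ k (≈-trans (only-separator _ fx) (≈-sym (only-separator _ fy)))

    aligned : ∀ p₁ p₂ X k → Occ p₁ X → Occ p₂ X → k < length X → f (p₁ + k) ≡ 0 → p₁ ≈ p₂
    aligned p₁ p₂ X k o₁ o₂ k<|X| f≡0 =
      same-separator p₁ p₂ k f≡0 (trans (sym (occ-agree p₁ p₂ X k o₁ o₂ k<|X|)) f≡0)

    -- Walking left from any occurrence in
    -- steps of δ, occurrences of X cover every position past K + δ, in particular a copy of
    -- the separator; hence X contains the separator and all its occurrences are aligned.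
    module SelfOverlap (X : List ℕ) (δ K : ℕ) (1≤δ : 1 ≤ δ) (δ≤|X| : δ ≤ length X)
                       (shift : ∀ y → K ≤ y → Occ (y + δ) X → Occ y X) where

      -- a copy of the separator position beyond K + δ
      t : ℕ
      t = m + (K + δ) * n

      Covering : Set
      Covering = Σ ℕ λ u → Occ u X × u ≤ t × t < u + length X

      cover : ∀ x → Occ x X → t < x + length X → Covering
      cover = <-rec (λ x → Occ x X → t < x + length X → Covering) walk
        where
        walk : ∀ x → (∀ {y} → y < x → Occ y X → t < y + length X → Covering) →
               Occ x X → t < x + length X → Covering
        walk x recurse at-x t<x+|X| with x ≤? t
        ... | yes x≤t = x , at-x , x≤t , t<x+|X|
        ... | no x≰t = recurse y<x (shift y K≤y (subst (λ z → Occ z X) (sym y+δ≡x) at-x)) t<y+|X|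
          where
          t<x : t < x
          t<x = ≰⇒> x≰t
          K+δ≤x : K + δ ≤ x
          K+δ≤x = ≤-trans (≤-trans (m≤m*n (K + δ) n) (m≤n+m _ m)) (<⇒≤ t<x)
          y : ℕ
          y = x ∸ δ
          y+δ≡x : y + δ ≡ x
          y+δ≡x = m∸n+n≡m (≤-trans (m≤n+m δ K) K+δ≤x)
          K≤y : K ≤ y
          K≤y = subst (_≤ y) (m+n∸n≡m K δ) (∸-monoˡ-≤ δ K+δ≤x)
          y<x : y < x
          y<x = subst (y <_) y+δ≡x (subst (_≤ y + δ) (+-comm y 1) (+-monoʳ-≤ y 1≤δ))
          t<y+|X| : t < y + length X
          t<y+|X| = ≤-trans t<x (subst (_≤ y + length X) y+δ≡x (+-monoʳ-≤ y δ≤|X|))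

      all-aligned : ∀ {p₁ p₂} → Occ p₁ X → Occ p₂ X → p₁ ≈ p₂
      all-aligned {p₁} {p₂} o₁ o₂ = from-covering (cover far far-occ t<far+|X|)
        where
        -- a copy of the occurrence p₁ to the right of t
        far : ℕ
        far = p₁ + suc (K + δ) * n
        far-occ : Occ far X
        far-occ = occ-≈ X (≈-sym (+-turns p₁ (suc (K + δ)))) o₁
        t<far+|X| : t < far + length X
        t<far+|X| = ≤-trans (m≤n+m (suc t) p₁) (m≤m+n far (length X))

        from-covering : Covering → p₁ ≈ p₂
        from-covering (u , at-u , u≤t , t<u+|X|) =
          aligned p₁ p₂ X r o₁ o₂ r<|X| (trans (occ-agree p₁ u X r o₁ at-u r<|X|) (trans (cong f u+r≡t) f-t≡0))
          where
          r : ℕ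
          r = t ∸ u
          u+r≡t : u + r ≡ t
          u+r≡t = m+[n∸m]≡n u≤t
          r<|X| : r < length X
          r<|X| = +-cancelˡ-< u r (length X) (subst (_< u + length X) (sym u+r≡t) t<u+|X|)
          f-t≡0 : f t ≡ 0
          f-t≡0 = trans (periodic (+-turns m (K + δ))) separator

    -- Then the longer suffix overlaps itself with shift d' ∸ d,
    -- so all its occurrences, and hence s₁ and s₂, are aligned.
    nested-suffixes : ∀ V {d d' p s₁ s₂} → d < d' → d' ≤ length V →
                      (∀ z → Occ (z + d') (drop d' V) → Occ z V) →
                      Occ p (drop d V) → Occ p (drop d' V) → Occ s₁ V → Occ s₂ V → s₁ ≈ s₂
    nested-suffixes V {d} {d'} {p} {s₁} {s₂} d<d' d'≤|V| extends long-at-p short-at-p at-s₁ at-s₂ =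
      +-cancelʳ-≈ d (SelfOverlap.all-aligned long δ d (m<n⇒0<n∸m d<d') δ≤|long| shift
                       (occ-drop s₁ d V at-s₁) (occ-drop s₂ d V at-s₂))
      where
      long short : List ℕ
      long  = drop d V
      short = drop d' V
      δ : ℕ
      δ = d' ∸ d
      δ≤|long| : δ ≤ length long
      δ≤|long| = subst (δ ≤_) (sym (length-drop d V)) (∸-monoˡ-≤ d d'≤|V|)
      |short|≤|long| : length short ≤ length long
      |short|≤|long| =
        subst₂ _≤_ (sym (length-drop d' V)) (sym (length-drop d V)) (∸-monoʳ-≤ (length V) (<⇒≤ d<d'))
      shift : ∀ y → d ≤ y → Occ (y + δ) long → Occ y long
      shift y d≤y o = subst (λ x → Occ x long) (m∸n+n≡m d≤y) (occ-drop (y ∸ d) d V (extends (y ∸ d) short-at))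
        where
        y∸d+d'≡ : y ∸ d + d' ≡ y + δ
        y∸d+d'≡ = trans (sym (+-∸-comm d' d≤y)) (+-∸-assoc y (<⇒≤ d<d'))
        short-at : Occ (y ∸ d + d') short
        short-at = subst (λ x → Occ x short) (sym y∸d+d'≡)
                     (occ-prefix p (y + δ) short long short-at-p long-at-p |short|≤|long| o)

-- The circular text T; arcs of its CDAWG and the suffixes whose paths traverse them.
module CDAWGText (m σ : ℕ) (T : Fin (suc m) → ℕ) (valid : ValidText m σ T) where

  open Congruence m
  open Occurrence (circ T)

  periodic : ∀ {x y} → x ≈ y → circ T x ≡ circ T y
  periodic e = cong T (mod-cong e)

  cell-cases : ∀ (k : Fin n) → k ≡ fromℕ m ⊎ Σ (Fin m) λ i → inject₁ i ≡ k
  cell-cases k with m ≟ toℕ k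
  ... | yes m≡k = inj₁ (FP.toℕ-injective (trans (sym m≡k) (sym (FP.toℕ-fromℕ m))))
  ... | no  m≢k = inj₂ (F.lower₁ k m≢k , FP.inject₁-lower₁ k m≢k)

  separator : circ T m ≡ 0
  separator = trans (cong T m-mod-n) (proj₁ valid)
    where
    m-mod-n : m mod n ≡ fromℕ m
    m-mod-n = FP.toℕ-injective
      (trans (FP.toℕ-fromℕ< (m%n<n m n)) (trans (m<n⇒m%n≡m (n<1+n m)) (sym (FP.toℕ-fromℕ m))))

  only-separator : ∀ x → circ T x ≡ 0 → x ≈ m
  only-separator x T≡0 with cell-cases (x mod n)
  ... | inj₁ last = ≈-trans (≈-sym (toℕ-mod-≈ x)) (≡⇒≈ (trans (cong toℕ last) (FP.toℕ-fromℕ m)))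
  ... | inj₂ (i , inner) = ⊥-elim (1+n≰n (subst (1 ≤_) (trans (cong T inner) T≡0) (proj₁ (proj₂ valid i))))

  bounded : ∀ x → circ T x ≤ σ
  bounded x with cell-cases (x mod n)
  ... | inj₁ last = subst (_≤ σ) (sym (trans (cong T last) (proj₁ valid))) z≤n
  ... | inj₂ (i , inner) = subst (λ k → T k ≤ σ) inner (proj₂ (proj₂ valid i))

  open PeriodicStream m (circ T) periodic
  open Separated separator only-separator

  occurs : ∀ x X → Occ x X → Occurs T X
  occurs x X o = x mod n , occ-≈ X (≈-sym (toℕ-mod-≈ x)) o

  repeat : ∀ X {x y} → ¬ x ≈ y → Occ x X → Occ y X → Repeat T X
  repeat X {x} {y} x≉y ox oy =
    x mod n , y mod n , distinct , occ-≈ X (≈-sym (toℕ-mod-≈ x)) ox , occ-≈ X (≈-sym (toℕ-mod-≈ y)) oy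
    where
    distinct : x mod n ≢ y mod n
    distinct e = x≉y (≈-trans (≈-sym (toℕ-mod-≈ x)) (≈-trans (≡⇒≈ (cong toℕ e)) (toℕ-mod-≈ y)))

  right-extension : ∀ x X c → Occ x (X ++ [ c ]) → InSigmaR σ T X c
  right-extension x X c o = subst (_≤ σ) (snoc-char x X c o) (bounded (x + length X)) , occurs x (X ++ [ c ]) o

  left-extension : ∀ x X → Occ (suc x) X → InSigmaL σ T X (circ T x)
  left-extension x X o = bounded x , occurs x (circ T x ∷ X) (refl , o)

  -- Uses i (V , b): the path spelled by the suffix at i traverses the arc (V , b), i.e.
  -- some suffix U = drop d V lies in the class of V (every occurrence of U extends to
  -- one of V) and U b is a prefix of the suffix at i.
  Uses : Fin n → List ℕ × ℕ → Set
  Uses i (V , b) = Σ (Fin (suc (length V))) λ d →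
    Occ (toℕ i) (drop (toℕ d) V ++ [ b ]) × Preceded (toℕ d) (drop (toℕ d) V) V

  Uses? : ∀ i a → Dec (Uses i a)
  Uses? i (V , b) = FP.any? λ d →
    Occ? (toℕ i) (drop (toℕ d) V ++ [ b ]) ×-dec Preceded? (toℕ d) (drop (toℕ d) V) V

  uses : ∀ i V b d → d ≤ length V → Occ (toℕ i) (drop d V ++ [ b ]) → Preceded d (drop d V) V → Uses i (V , b)
  uses i V b d d≤|V| o pre = F.fromℕ< (s≤s d≤|V|) ,
    subst (λ e → Occ (toℕ i) (drop e V ++ [ b ]) × Preceded e (drop e V) V)
          (sym (FP.toℕ-fromℕ< (s≤s d≤|V|))) (o , pre)

  -- W is the longest common prefix of the two suffixes, followed by
  -- b ≢ b'; V is the maximal repeat of the class of W, obtained by extending W to the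
  -- left as long as all occurrences of W agree; the arc is (V , b).
  module Separation (i j : Fin n) (i≢j : i ≢ j) where

    pᵢ pⱼ : ℕ
    pᵢ = toℕ i
    pⱼ = toℕ j

    apart : ¬ pᵢ ≈ pⱼ
    apart e = i≢j (toℕ-≈-injective e)

    Mismatch : ℕ → Set
    Mismatch k = circ T (pᵢ + k) ≢ circ T (pⱼ + k)

    -- the two suffixes cannot both read the separator at the same offset
    mismatch-at-separator : Mismatch (proj₁ (separator-ahead pᵢ))
    mismatch-at-separator e = apart (same-separator pᵢ pⱼ _ at-sep (trans (sym e) at-sep))
      where
      at-sep : circ T (pᵢ + proj₁ (separator-ahead pᵢ)) ≡ 0
      at-sep = proj₂ (proj₂ (separator-ahead pᵢ))

    -- opaque: the search is used only through its specification, and unfolding it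
    -- during type checking is prohibitively expensive
    opaque
      first-mismatch : Σ ℕ λ L → Mismatch L × (∀ k → k < L → ¬ Mismatch k)
      first-mismatch = least Mismatch (λ k → ¬? (circ T (pᵢ + k) ≟ circ T (pⱼ + k))) _ mismatch-at-separator

    L : ℕ
    L = proj₁ first-mismatch

    agree-below : ∀ k → k < L → circ T (pᵢ + k) ≡ circ T (pⱼ + k)
    agree-below k k<L = decidable-stable (circ T (pᵢ + k) ≟ circ T (pⱼ + k)) (proj₂ (proj₂ first-mismatch) k k<L)

    W : List ℕ
    W = factor pᵢ L

    b b' : ℕ
    b  = circ T (pᵢ + L)
    b' = circ T (pⱼ + L)

    b≢b' : b ≢ b'
    b≢b' = proj₁ (proj₂ first-mismatch)

    |W| : length W ≡ L
    |W| = length-factor pᵢ L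

    W-at-j : Occ pⱼ W
    W-at-j = occ-factor pᵢ pⱼ L agree-below

    Wb-at-i : Occ pᵢ (W ++ [ b ])
    Wb-at-i = occ-snoc pᵢ W b (factor-occ pᵢ L) (cong (λ k → circ T (pᵢ + k)) |W|)

    Wb'-at-j : Occ pⱼ (W ++ [ b' ])
    Wb'-at-j = occ-snoc pⱼ W b' W-at-j (cong (λ k → circ T (pⱼ + k)) |W|)

    -- ext d: W preceded by the d characters in front of its occurrence at pᵢ
    ext : ℕ → List ℕ
    ext d = factor (d * m + pᵢ) (d + L)

    drop-ext : ∀ d → drop d (ext d) ≡ W
    drop-ext d = trans (drop-factor (d * m + pᵢ) d L) (factor-≈ L (back d pᵢ))

    Extends : ℕ → Set
    Extends d = Preceded d W (ext d)

    Extends? : ∀ d → Dec (Extends d)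
    Extends? d = Preceded? d W (ext d)

    extends-0 : Extends 0
    extends-0 q o = subst (λ x → Occ x W) (+-identityʳ (toℕ q)) o

    -- a full turn cannot be an extension: ext n contains the separator, so its
    -- occurrences in front of pᵢ and pⱼ would be aligned
    ¬extends-n : ¬ Extends n
    ¬extends-n extends-n = apart (≈-trans (≈-sym start≈pᵢ) start≈pⱼ)
      where
      start : ℕ
      start = n * m + pᵢ
      start≈pᵢ : start ≈ pᵢ
      start≈pᵢ = ≈-trans (≈-sym (+-turn start)) (back n pᵢ)
      at-pⱼ : Occ pⱼ (ext n)
      at-pⱼ = preceded extends-n pⱼ (occ-≈ W (≈-sym (+-turn pⱼ)) W-at-j)
      sep : Σ ℕ λ t → t < n × circ T (start + t) ≡ 0
      sep = separator-ahead start
      sep-inside : proj₁ sep < length (ext n)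
      sep-inside = subst (proj₁ sep <_) (sym (length-factor start (n + L))) (≤-trans (proj₁ (proj₂ sep)) (m≤m+n n L))
      start≈pⱼ : start ≈ pⱼ
      start≈pⱼ = aligned start pⱼ (ext n) (proj₁ sep) (factor-occ start (n + L)) at-pⱼ sep-inside (proj₂ (proj₂ sep))

    -- d* is the largest extension length: Extends d*, but not Extends (suc d*)
    opaque
      maximal-extension : Σ ℕ λ d → ¬ Extends (suc d) × (∀ d' → d' < d → ¬ ¬ Extends (suc d'))
      maximal-extension = least (λ d → ¬ Extends (suc d)) (λ d → ¬? (Extends? (suc d))) m ¬extends-n

    d* : ℕ
    d* = proj₁ maximal-extension

    extends-d* : Extends d*
    extends-d* with d* | proj₂ (proj₂ maximal-extension)
    ... | zero  | _     = extends-0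
    ... | suc d | below = decidable-stable (Extends? (suc d)) (below d ≤-refl)

    V : List ℕ
    V = ext d*

    |V| : length V ≡ d* + L
    |V| = length-factor (d* * m + pᵢ) (d* + L)

    d*≤|V| : d* ≤ length V
    d*≤|V| = subst (d* ≤_) (sym |V|) (m≤m+n d* L)

    W-suffix : drop d* V ≡ W
    W-suffix = drop-ext d*

    V-before-W : ∀ z → Occ (z + d*) W → Occ z V
    V-before-W = preceded extends-d*

    lift : ∀ p c → Occ p (W ++ [ c ]) → Occ (d* * m + p) (V ++ [ c ])
    lift p c o = occ-snoc z V c V-at-z (trans (periodic end≈) (snoc-char p W c o))
      where
      z : ℕ
      z = d* * m + p
      V-at-z : Occ z V
      V-at-z = V-before-W z (occ-≈ W (≈-sym (back d* p)) (proj₁ (occ-++⁻ p W [ c ] o)))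
      rearrange : ∀ d m p L → d * m + p + (d + L) ≡ d * m + (p + L) + d
      rearrange = solve-∀
      end≈ : z + length V ≈ p + length W
      end≈ = ≈-trans (≡⇒≈ (trans (cong (z +_) |V|) (rearrange d* m p L)))
                     (≈-trans (back d* (p + L)) (≡⇒≈ (cong (p +_) (sym |W|))))

    sᵢ sⱼ : ℕ
    sᵢ = d* * m + pᵢ
    sⱼ = d* * m + pⱼ

    Vb-at-sᵢ : Occ sᵢ (V ++ [ b ])
    Vb-at-sᵢ = lift pᵢ b Wb-at-i

    Vb'-at-sⱼ : Occ sⱼ (V ++ [ b' ])
    Vb'-at-sⱼ = lift pⱼ b' Wb'-at-j

    V-at-sᵢ : Occ sᵢ V
    V-at-sᵢ = proj₁ (occ-++⁻ sᵢ V [ b ] Vb-at-sᵢ)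

    V-at-sⱼ : Occ sⱼ V
    V-at-sⱼ = proj₁ (occ-++⁻ sⱼ V [ b' ] Vb'-at-sⱼ)

    V-apart : ¬ sᵢ ≈ sⱼ
    V-apart e = apart (+-cancelˡ-≈ (d* * m) e)

    right-maximal : RightMaximal σ T V
    right-maximal = b , b' , b≢b' , right-extension sᵢ V b Vb-at-sᵢ , right-extension sⱼ V b' Vb'-at-sⱼ

    s₀ : ℕ
    s₀ = suc d* * m + pᵢ

    ext-suc : ext (suc d*) ≡ circ T s₀ ∷ V
    ext-suc = cong (circ T s₀ ∷_) (factor-≈ (d* + L) (back-suc d* pᵢ))

    -- an occurrence of W not preceded by ext (suc d*) gives an occurrence of V
    -- preceded by a character other than circ T s₀
    left-maximal : LeftMaximal σ T V
    left-maximal with FP.¬∀⟶∃¬ n _ (λ q → Occ? (toℕ q + suc d*) W →-dec Occ? (toℕ q) (ext (suc d*)))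
                                    (proj₁ (proj₂ maximal-extension))
    ... | q , not-preceded with Occ? (toℕ q + suc d*) W
    ...   | no ¬W-at = ⊥-elim (not-preceded (λ W-at → ⊥-elim (¬W-at W-at)))
    ...   | yes W-at = circ T (toℕ q) , circ T s₀ , differ ,
                       left-extension (toℕ q) V V-at-q+1 ,
                       left-extension s₀ V (occ-≈ V (≈-sym (back-suc d* pᵢ)) V-at-sᵢ)
      where
      V-at-q+1 : Occ (suc (toℕ q)) V
      V-at-q+1 = V-before-W (suc (toℕ q)) (subst (λ x → Occ x W) (+-suc (toℕ q) d*) W-at)
      differ : circ T (toℕ q) ≢ circ T s₀
      differ e = not-preceded (λ _ → subst (Occ (toℕ q)) (sym ext-suc) (e , V-at-q+1))

    arc : CDAWGArc σ T (V , b)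
    arc = (repeat V V-apart V-at-sᵢ V-at-sⱼ , left-maximal , right-maximal) , right-extension sᵢ V b Vb-at-sᵢ

    i-uses : Uses i (V , b)
    i-uses = uses i V b d* d*≤|V|
      (subst (λ X → Occ pᵢ (X ++ [ b ])) (sym W-suffix) Wb-at-i)
      (subst (λ X → Preceded d* X V) (sym W-suffix) extends-d*)

    -- the suffix at j could only use (V , b) through a suffix of V other than W
    -- (through W itself it would continue with b' ≢ b), contradicting nested-suffixes
    j-avoids : ¬ Uses j (V , b)
    j-avoids (d , Ub-at-j , U-preceded) = by-cases (<-cmp (toℕ d) d*)
      where
      U : List ℕ
      U = drop (toℕ d) V
      U-at-j : Occ pⱼ U
      U-at-j = proj₁ (occ-++⁻ pⱼ U [ b ] Ub-at-j)
      suffix-at-j : Occ pⱼ (drop d* V)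
      suffix-at-j = subst (Occ pⱼ) (sym W-suffix) W-at-j
      V-before-suffix : ∀ z → Occ (z + d*) (drop d* V) → Occ z V
      V-before-suffix z o = V-before-W z (subst (Occ (z + d*)) W-suffix o)

      by-cases : Tri (toℕ d < d*) (toℕ d ≡ d*) (d* < toℕ d) → ⊥
      by-cases (tri≈ _ d≡d* _) = b≢b' (trans (sym (snoc-char pⱼ U b Ub-at-j)) (cong (λ k → circ T (pⱼ + k)) |U|≡L))
        where
        |U|≡L : length U ≡ L
        |U|≡L = trans (length-drop (toℕ d) V) (trans (cong₂ _∸_ |V| d≡d*) (m+n∸m≡n d* L))
      by-cases (tri< d<d* _ _) =
        V-apart (nested-suffixes V d<d* d*≤|V| V-before-suffix U-at-j suffix-at-j V-at-sᵢ V-at-sⱼ)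
      by-cases (tri> _ _ d*<d) =
        V-apart (nested-suffixes V d*<d (≤-pred (FP.toℕ<n d)) (preceded U-preceded) suffix-at-j U-at-j V-at-sᵢ V-at-sⱼ)

  separating-arc : ∀ i j → i ≢ j → Σ (List ℕ × ℕ) λ a → CDAWGArc σ T a × Uses i a × ¬ Uses j a
  separating-arc i j i≢j = (V , b) , arc , i-uses , j-avoids
    where open Separation i j i≢j

bit : ∀ {P : Set} → Dec P → Fin 2
bit (yes _) = F.suc F.zero
bit (no _)  = F.zero

bit-differs : ∀ {P Q : Set} (p : Dec P) (q : Dec Q) → P → ¬ Q → bit p ≢ bit q
bit-differs (yes _) (yes q) _ ¬q _ = ¬q q
bit-differs (yes _) (no _)  _ _  ()
bit-differs (no ¬p) _       p _  _ = ¬p p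

-- Counting by separation: if any two distinct elements of Fin n are told apart by some
-- entry of xs (R holds for the first and not for the second), then the bit vectors
-- (R i x)_{x ∈ xs} are pairwise distinct, so n ≤ 2 ^ length xs.
separated-bound : ∀ {A : Set} n (R : Fin n → A → Set) → (∀ i x → Dec (R i x)) → (xs : List A) →
                  (∀ i j → i ≢ j → Σ A λ x → x ∈ xs × R i x × ¬ R j x) → n ≤ 2 ^ length xs
separated-bound n R R? xs separates with n ≤? 2 ^ length xs
... | yes n≤2^e = n≤2^e
... | no  n≰2^e = ⊥-elim (no-collision (FP.pigeonhole (≰⇒> n≰2^e) code))
  where
  code : Fin n → Fin (2 ^ length xs)
  code i = funToFin (λ k → bit (R? i (lookup xs k)))

  no-collision : (∃ λ i → ∃ λ j → i F.< j × code i ≡ code j) → ⊥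
  no-collision (i , j , i<j , same-code) = bit-differs (R? i (lookup xs k)) (R? j (lookup xs k)) Ri ¬Rj same-bit
    where
    separation : Σ _ λ x → x ∈ xs × R i x × ¬ R j x
    separation = separates i j (λ i≡j → <-irrefl (cong toℕ i≡j) i<j)
    x∈xs : proj₁ separation ∈ xs
    x∈xs = proj₁ (proj₂ separation)
    k : Fin (length xs)
    k = index x∈xs
    Ri : R i (lookup xs k)
    Ri = subst (R i) (lookup-index x∈xs) (proj₁ (proj₂ (proj₂ separation)))
    ¬Rj : ¬ R j (lookup xs k)
    ¬Rj = subst (λ x → ¬ R j x) (lookup-index x∈xs) (proj₂ (proj₂ (proj₂ separation)))
    same-bit : bit (R? i (lookup xs k)) ≡ bit (R? j (lookup xs k))
    same-bit = begin
        bit (R? i (lookup xs k))                                  ≡⟨ FP.finToFun-funToFin _ k ⟨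
        finToFun (code i) k                                       ≡⟨ cong (λ c → finToFun c k) same-code ⟩
        finToFun (code j) k                                       ≡⟨ FP.finToFun-funToFin _ k ⟩
        bit (R? j (lookup xs k))                                  ∎
      where open ≡-Reasoning

positions-bound : ∀ m σ (T : Fin (suc m) → ℕ) → ValidText m σ T → (arcs : List (List ℕ × ℕ)) →
                  ((V : List ℕ) → (b : ℕ) → ((V , b) ∈ arcs ⇔ CDAWGArc σ T (V , b))) →
                  suc m ≤ 2 ^ length arcs
positions-bound m σ T valid arcs arcs-exact = separated-bound (suc m) Uses Uses? arcs separates
  where
  open CDAWGText m σ T valid
  separates : ∀ i j → i ≢ j → Σ (List ℕ × ℕ) λ a → a ∈ arcs × Uses i a × ¬ Uses j a
  separates i j i≢j with separating-arc i j i≢j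
  ... | (V , b) , is-arc , i-uses , j-avoids = (V , b) , Equivalence.from (arcs-exact V b) is-arc , i-uses , j-avoids

lemma4 : ∃[ c ] ∃[ n₀ ] ((1 ≤ c) ×
           ((m σ : ℕ) → n₀ ≤ suc m → σ < m →
            (T : Fin (suc m) → ℕ) → ValidText m σ T →
            (arcs : List (List ℕ × ℕ)) → Unique arcs →
            ((V : List ℕ) → (b : ℕ) → ((V , b) ∈ arcs ⇔ CDAWGArc σ T (V , b))) →
            ⌊log₂ (suc m) ⌋ ≤ c * length arcs))
lemma4 = 1 , 1 , ≤-refl , λ m σ _ _ T valid arcs _ arcs-exact → begin
    ⌊log₂ (suc m) ⌋               ≤⟨ ⌊log₂⌋-mono-≤ (positions-bound m σ T valid arcs arcs-exact) ⟩
    ⌊log₂ (2 ^ length arcs) ⌋     ≡⟨ ⌊log₂[2^n]⌋≡n (length arcs) ⟩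
    length arcs                   ≡⟨ *-identityˡ (length arcs) ⟨
    1 * length arcs               ∎
  where open ≤-Reasoning
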